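{- For every integer $t \ge 4$, there exists a doubly saturated $R(4,t)$-good graph on $6t-11$ vertices.
   Context: All graphs are simple and finite. For integers $s,t$, a graph is $R(s,t)$-good if it contains neither a clique on $s$ vertices nor an independent set of $t$ vertices. A graph $G$ is doubly saturated $R(s,t)$-good if (i) $G$ is $R(s,t)$-good, (ii) adding any edge to $G$ (i.e., joining any pair of non-adjacent distinct vertices) yields a graph that is not $R(s,t)$-good, (iii) removing any edge from $G$ yields a graph that is not $R(s,t)$-good, and (iv) neither $G$ nor its complement $\overline{G}$ is a complete graph. -}

module Defs where

open import Data.Nat using (ℕ)
open import Data.Fin using (Fin; _≟_)
open import Data.Bool using (Bool; true; false; _∧_; _∨_; not; if_then_else_)
open import Data.Product using (Σ; ∃; _×_; _,_)
open import Relation.Binary.PropositionalEquality using (_≡_; _≢_)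
open import Relation.Nullary using (¬_; does)
open import Function.Definitions using (Injective)

record Graph (n : ℕ) : Set where
  field
    adj   : Fin n → Fin n → Bool
    sym   : ∀ u v → adj u v ≡ adj v u
    irrefl : ∀ v → adj v v ≡ false
open Graph public

HasClique : ∀ {n} → Graph n → ℕ → Set
HasClique {n} G s =
  Σ (Fin s → Fin n) λ f → Injective _≡_ _≡_ f ×
    (∀ i j → i ≢ j → adj G (f i) (f j) ≡ true)

HasIndep : ∀ {n} → Graph n → ℕ → Set
HasIndep {n} G t =
  Σ (Fin t → Fin n) λ f → Injective _≡_ _≡_ f ×
    (∀ i j → i ≢ j → adj G (f i) (f j) ≡ false)

RGood : ∀ {n} → ℕ → ℕ → Graph n → Set
RGood s t G = ¬ HasClique G s × ¬ HasIndep G t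

samePair : ∀ {n} → Fin n → Fin n → Fin n → Fin n → Bool
samePair u v x y =
  (does (x ≟ u) ∧ does (y ≟ v)) ∨ (does (x ≟ v) ∧ does (y ≟ u))

setPair : ∀ {n} (G : Graph n) (u v : Fin n) → u ≢ v → Bool → Graph n
setPair G u v u≢v b = record
  { adj    = λ x y → if samePair u v x y then b else adj G x y
  ; sym    = symP
  ; irrefl = irrP
  }
  where
  open import Relation.Binary.PropositionalEquality using (refl; cong; sym)
  open import Data.Bool.Properties using (∧-comm; ∨-comm)
  symP : ∀ x y → (if samePair u v x y then b else adj G x y)
               ≡ (if samePair u v y x then b else adj G y x)
  symP x y rewrite ∧-comm (does (x ≟ u)) (does (y ≟ v))
                 | ∧-comm (does (x ≟ v)) (does (y ≟ u))
                 | ∨-comm (does (y ≟ v) ∧ does (x ≟ u)) (does (y ≟ u) ∧ does (x ≟ v))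
                 | Graph.sym G x y = refl
  irrP : ∀ x → (if samePair u v x x then b else adj G x x) ≡ false
  irrP x with x ≟ u | x ≟ v
  ... | Relation.Nullary.yes refl | Relation.Nullary.yes refl = Relation.Nullary.contradiction refl u≢v
  ... | Relation.Nullary.yes _ | Relation.Nullary.no _ = Graph.irrefl G x
  ... | Relation.Nullary.no _ | Relation.Nullary.yes _ = Graph.irrefl G x
  ... | Relation.Nullary.no _ | Relation.Nullary.no _ = Graph.irrefl G x

addEdge : ∀ {n} (G : Graph n) (u v : Fin n) → u ≢ v → Graph n
addEdge G u v p = setPair G u v p true

removeEdge : ∀ {n} (G : Graph n) (u v : Fin n) → u ≢ v → Graph n
removeEdge G u v p = setPair G u v p false

IsComplete : ∀ {n} → Graph n → Set
IsComplete {n} G = ∀ (u v : Fin n) → u ≢ v → adj G u v ≡ true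

ComplementComplete : ∀ {n} → Graph n → Set
ComplementComplete {n} G = ∀ (u v : Fin n) → u ≢ v → adj G u v ≡ false

DoublySaturated : ∀ {n} → ℕ → ℕ → Graph n → Set
DoublySaturated {n} s t G =
  RGood s t G ×
  (∀ (u v : Fin n) (p : u ≢ v) → adj G u v ≡ false → ¬ RGood s t (addEdge G u v p)) ×
  (∀ (u v : Fin n) (p : u ≢ v) → adj G u v ≡ true  → ¬ RGood s t (removeEdge G u v p)) ×
  ¬ IsComplete G × ¬ ComplementComplete G

-- For k = t − 2 the witness is the circulant graph on ℤ/(6k+1) whose connection set is
-- {k, −k} ∪ [2k+1, 4k].
--
-- A K₄ cuts the cycle into four arcs whose lengths, and the sums of two consecutive ones, are
-- connection lengths. Every arc is k or longer than 2k, and two consecutive arcs cannot both be k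
-- because 2k is not a connection length; so the arcs add up to at least 6k + 2 > 6k + 1.
--
-- An independent set lies within distance 2k of each of its vertices, hence in an arc of 4k + 1
-- vertices; inside it, distances in (2k, 4k] are connection lengths, so the set even lies in an
-- arc of 2k + 1 vertices. Splitting that arc into the k + 1 classes {c, c + k} (c < k) and {2k}
-- shows that k + 2 vertices would contain two at distance k.
--
-- Saturation: if the pair {u, v} is changed, by the symmetry d ↦ −d we may assume that
-- d = v − u satisfies 0 < d ≤ 2k (new edge) or d = k or 2k < d ≤ 3k (removed edge); for each
-- such d an explicit K₄, resp. an independent set of k + 2 vertices, is listed as a set of
-- offsets from u, built from a few intervals.
module Submission where

open import Data.Bool using (Bool; true; false; if_then_else_; _∧_)
open import Data.Bool.Properties using (∨-comm)
open import Data.Empty using (⊥; ⊥-elim)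
open import Data.Fin as Fin using (Fin; toℕ; fromℕ<)
open import Data.Fin.Patterns using (0F; 1F; 2F; 3F)
import Data.Fin.Properties as Finₚ
open import Data.List as L using (List; []; _∷_; _++_; length; lookup; map; applyUpTo; concatMap; allFin)
open import Data.List.Extrema.Nat using (argmin; f[argmin]≤f[xs])
open import Data.List.Membership.Propositional.Properties using (∈-allFin; ∈-lookup)
open import Data.List.Properties using (length-++; length-applyUpTo; length-map)
open import Data.List.Relation.Unary.All as All using (All; []; _∷_)
import Data.List.Relation.Unary.All.Properties as Allₚ
open import Data.List.Relation.Unary.AllPairs as AllPairs using (AllPairs; []; _∷_)
import Data.List.Relation.Unary.AllPairs.Properties as AllPairsₚ
open import Data.Nat
open import Data.Nat.DivMod
open import Data.Nat.ListAction using (sum)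
open import Data.Nat.Properties
open import Data.Nat.Tactic.RingSolver using (solve)
open import Data.Product using (Σ; ∃₂; _×_; _,_; proj₁; proj₂)
open import Data.Sum as Sum using (_⊎_; inj₁; inj₂)
open import Function using (_∘_)
open import Function.Bundles using (mk⇔)
open import Function.Definitions using (Injective)
open import Relation.Binary.Definitions using (tri<; tri≈; tri>)
open import Relation.Binary.PropositionalEquality hiding ([_])
open import Relation.Nullary using (Dec; ¬_; yes; no; does)
open import Relation.Nullary.Decidable using (dec-true; dec-false; does-⇔)
open import Relation.Unary using (Decidable)

open import Defs hiding (sym)

-- HasClique G s and HasIndep G s unfold to Homogeneous G true s and Homogeneous G false s.
Homogeneous : ∀ {n} → Graph n → Bool → ℕ → Set
Homogeneous {n} G b s =
  Σ (Fin s → Fin n) λ f → Injective _≡_ _≡_ f × (∀ i j → i ≢ j → adj G (f i) (f j) ≡ b)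

does≡true⇒ : ∀ {A : Set} (a? : Dec A) → does a? ≡ true → A
does≡true⇒ (yes a) _ = a
does≡true⇒ (no _)  ()

does≡false⇒ : ∀ {A : Set} (a? : Dec A) → does a? ≡ false → ¬ A
does≡false⇒ (yes _)  ()
does≡false⇒ (no ¬a) _ = ¬a

AllPairs-lookup : ∀ {A : Set} {R : A → A → Set} {xs : List A} → AllPairs R xs →
                  ∀ {i j} → i Fin.< j → R (lookup xs i) (lookup xs j)
AllPairs-lookup (Rx ∷ _)  {Fin.zero}  {Fin.suc j} _         = All.lookup Rx (∈-lookup j)
AllPairs-lookup (_ ∷ Rxs) {Fin.suc i} {Fin.suc j} (s≤s i<j) = AllPairs-lookup Rxs i<j

AllPairs-withAll : ∀ {A : Set} {P : A → Set} {R : A → A → Set} {xs} → All P xs → AllPairs R xs →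
                   AllPairs (λ x y → R x y × P y) xs
AllPairs-withAll []       []         = []
AllPairs-withAll (_ ∷ ps) (rs ∷ rss) =
  All.map (λ (r , p) → r , p) (All.zip (rs , ps)) ∷ AllPairs-withAll ps rss

module _ {n} (G : Graph n) (b : Bool) where

  HomogeneousPair : Fin n → Fin n → Set
  HomogeneousPair x y = x ≢ y × adj G x y ≡ b

  homogeneous-fromList : (xs : List (Fin n)) → AllPairs HomogeneousPair xs →
                         Homogeneous G b (length xs)
  homogeneous-fromList xs pairs = lookup xs , injective , related
    where
    related : ∀ i j → i ≢ j → adj G (lookup xs i) (lookup xs j) ≡ b
    related i j i≢j with Finₚ.<-cmp i j
    ... | tri< i<j _ _ = proj₂ (AllPairs-lookup pairs i<j)
    ... | tri≈ _ i≡j _ = ⊥-elim (i≢j i≡j)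
    ... | tri> _ _ j<i = trans (Graph.sym G _ _) (proj₂ (AllPairs-lookup pairs j<i))

    injective : Injective _≡_ _≡_ (lookup xs)
    injective {i} {j} eq with Finₚ.<-cmp i j
    ... | tri< i<j _ _ = ⊥-elim (proj₁ (AllPairs-lookup pairs i<j) eq)
    ... | tri≈ _ i≡j _ = i≡j
    ... | tri> _ _ j<i = ⊥-elim (proj₁ (AllPairs-lookup pairs j<i) (sym eq))

module _ {n} (G : Graph n) (u v : Fin n) (b : Bool) where

  setPair-adj-≡ : ∀ u≢v {x y} → adj G x y ≡ b → adj (setPair G u v u≢v b) x y ≡ b
  setPair-adj-≡ u≢v {x} {y} eq with samePair u v x y
  ... | true  = refl
  ... | false = eq

  setPair-adj-pair : ∀ u≢v → adj (setPair G u v u≢v b) u v ≡ b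
  setPair-adj-pair u≢v with u Fin.≟ u | v Fin.≟ v
  ... | yes _  | yes _  = refl
  ... | no u≢u | _      = ⊥-elim (u≢u refl)
  ... | yes _  | no v≢v = ⊥-elim (v≢v refl)

  homogeneous-setPair-comm : ∀ u≢v v≢u {s} → Homogeneous (setPair G v u v≢u b) b s →
                             Homogeneous (setPair G u v u≢v b) b s
  homogeneous-setPair-comm u≢v v≢u (f , f-inj , rel) = f , f-inj , λ i j i≢j →
    trans (cong (if_then b else adj G (f i) (f j))
                (∨-comm (does (f i Fin.≟ u) ∧ does (f j Fin.≟ v)) _))
          (rel i j i≢j)

-- Arithmetic in ℤ/n

module Cyclic (m : ℕ) where

  n : ℕ
  n = suc m

  private
    %-absorbʳ : ∀ a c → (a + c % n) % n ≡ (a + c) % n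
    %-absorbʳ a c = begin
      (a + c % n) % n           ≡⟨ %-distribˡ-+ a (c % n) n ⟩
      (a % n + c % n % n) % n   ≡⟨ cong (λ t → (a % n + t) % n) (m%n%n≡m%n c n) ⟩
      (a % n + c % n) % n       ≡⟨ %-distribˡ-+ a c n ⟨
      (a + c) % n               ∎
      where open ≡-Reasoning

    %-absorbˡ : ∀ a c → (a % n + c) % n ≡ (a + c) % n
    %-absorbˡ a c = begin
      (a % n + c) % n   ≡⟨ cong (_% n) (+-comm (a % n) c) ⟩
      (c + a % n) % n   ≡⟨ %-absorbʳ c a ⟩
      (c + a) % n       ≡⟨ cong (_% n) (+-comm c a) ⟩
      (a + c) % n       ∎
      where open ≡-Reasoning

    %-cancelˡ : ∀ c {a b} → c ≤ n → (c + a) % n ≡ (c + b) % n → a % n ≡ b % n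
    %-cancelˡ c {a} {b} c≤n eq = begin
      a % n                       ≡⟨ [m+n]%n≡m%n a n ⟨
      (a + n) % n                 ≡⟨ cong (_% n) (complete a) ⟩
      ((n ∸ c) + (c + a)) % n     ≡⟨ %-absorbʳ (n ∸ c) (c + a) ⟨
      ((n ∸ c) + (c + a) % n) % n ≡⟨ cong (λ t → ((n ∸ c) + t) % n) eq ⟩
      ((n ∸ c) + (c + b) % n) % n ≡⟨ %-absorbʳ (n ∸ c) (c + b) ⟩
      ((n ∸ c) + (c + b)) % n     ≡⟨ cong (_% n) (complete b) ⟨
      (b + n) % n                 ≡⟨ [m+n]%n≡m%n b n ⟩
      b % n                       ∎
      where
      open ≡-Reasoning
      complete : ∀ a → a + n ≡ (n ∸ c) + (c + a)
      complete a = begin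
        a + n                 ≡⟨ +-comm a n ⟩
        n + a                 ≡⟨ cong (_+ a) (m∸n+n≡m c≤n) ⟨
        (n ∸ c) + c + a       ≡⟨ +-assoc (n ∸ c) c a ⟩
        (n ∸ c) + (c + a)     ∎

  infixl 7 _⊖_ _⊕_

  -- Opaque, so that unification treats x ⊖ y and u ⊕ a as rigid.
  opaque
    _⊖_ : Fin n → Fin n → ℕ
    x ⊖ y = (toℕ x + (n ∸ toℕ y)) % n

    _⊕_ : Fin n → ℕ → Fin n
    u ⊕ a = fromℕ< (m%n<n (toℕ u + a) n)

    ⊖<n : ∀ x y → x ⊖ y < n
    ⊖<n x y = m%n<n (toℕ x + (n ∸ toℕ y)) n

    toℕ-⊕ : ∀ u a → toℕ (u ⊕ a) ≡ (toℕ u + a) % n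
    toℕ-⊕ u a = Finₚ.toℕ-fromℕ< _

    ⊖-spec : ∀ x y → (toℕ y + x ⊖ y) % n ≡ toℕ x
    ⊖-spec x y = begin
      (toℕ y + x ⊖ y) % n                 ≡⟨ %-absorbʳ (toℕ y) _ ⟩
      (toℕ y + (toℕ x + (n ∸ toℕ y))) % n 
        ≡⟨ cong (_% n) (rearrange (<⇒≤ (Finₚ.toℕ<n y))) ⟩
      (toℕ x + n) % n                     ≡⟨ [m+n]%n≡m%n (toℕ x) n ⟩
      toℕ x % n                           ≡⟨ m<n⇒m%n≡m (Finₚ.toℕ<n x) ⟩
      toℕ x                               ∎
      where
      open ≡-Reasoning
      rearrange : ∀ {a c} → c ≤ n → c + (a + (n ∸ c)) ≡ a + n
      rearrange {a} {c} c≤n = begin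
        c + (a + (n ∸ c))   ≡⟨ +-assoc c a (n ∸ c) ⟨
        c + a + (n ∸ c)     ≡⟨ cong (_+ (n ∸ c)) (+-comm c a) ⟩
        a + c + (n ∸ c)     ≡⟨ +-assoc a c (n ∸ c) ⟩
        a + (c + (n ∸ c))   ≡⟨ cong (a +_) (m+[n∸m]≡n c≤n) ⟩
        a + n               ∎

  ⊖-unique : ∀ {x y e} → (toℕ y + e) % n ≡ toℕ x → e < n → x ⊖ y ≡ e
  ⊖-unique {x} {y} {e} eq e<n = begin
    x ⊖ y         ≡⟨ m<n⇒m%n≡m (⊖<n x y) ⟨
    (x ⊖ y) % n   ≡⟨ %-cancelˡ (toℕ y) (<⇒≤ (Finₚ.toℕ<n y)) (trans (⊖-spec x y) (sym eq)) ⟩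
    e % n         ≡⟨ m<n⇒m%n≡m e<n ⟩
    e             ∎
    where open ≡-Reasoning

  ⊖-self : ∀ x → x ⊖ x ≡ 0
  ⊖-self x = ⊖-unique {x} {x}
    (trans (cong (_% n) (+-identityʳ (toℕ x))) (m<n⇒m%n≡m (Finₚ.toℕ<n x))) (s≤s z≤n)

  ⊕-⊖ : ∀ u {a} → a < n → u ⊕ a ⊖ u ≡ a
  ⊕-⊖ u {a} a<n = ⊖-unique {u ⊕ a} {u} (sym (toℕ-⊕ u a)) a<n

  ⊖-⊕ : ∀ u x → u ⊕ (x ⊖ u) ≡ x
  ⊖-⊕ u x = Finₚ.toℕ-injective (trans (toℕ-⊕ u (x ⊖ u)) (⊖-spec x u))

  ⊖-injectiveˡ : ∀ u {x y} → x ⊖ u ≡ y ⊖ u → x ≡ y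
  ⊖-injectiveˡ u {x} {y} eq = begin
    x               ≡⟨ ⊖-⊕ u x ⟨
    u ⊕ (x ⊖ u)     ≡⟨ cong (u ⊕_) eq ⟩
    u ⊕ (y ⊖ u)     ≡⟨ ⊖-⊕ u y ⟩
    y               ∎
    where open ≡-Reasoning

  ⊕-injectiveʳ : ∀ u {a b} → a < n → b < n → u ⊕ a ≡ u ⊕ b → a ≡ b
  ⊕-injectiveʳ u {a} {b} a<n b<n eq = begin
    a           ≡⟨ ⊕-⊖ u a<n ⟨
    u ⊕ a ⊖ u   ≡⟨ cong (_⊖ u) eq ⟩
    u ⊕ b ⊖ u   ≡⟨ ⊕-⊖ u b<n ⟩
    b           ∎
    where open ≡-Reasoning

  ⊖-pos : ∀ {x y} → x ≢ y → 0 < x ⊖ y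
  ⊖-pos {x} {y} x≢y =
    n≢0⇒n>0 λ x⊖y≡0 → x≢y (⊖-injectiveˡ y (trans x⊖y≡0 (sym (⊖-self y))))

  ⊖-rebase : ∀ u {x y c} → y ⊖ u + c ≡ x ⊖ u → x ⊖ y ≡ c
  ⊖-rebase u {x} {y} {c} eq =
    ⊖-unique {x} {y} reach (≤-<-trans (m≤n+m c (y ⊖ u)) (subst (_< n) (sym eq) (⊖<n x u)))
    where
    open ≡-Reasoning
    reach : (toℕ y + c) % n ≡ toℕ x
    reach = begin
      (toℕ y + c) % n                 ≡⟨ cong (λ t → (t + c) % n) (⊖-spec y u) ⟨
      ((toℕ u + y ⊖ u) % n + c) % n   ≡⟨ %-absorbˡ (toℕ u + y ⊖ u) c ⟩
      (toℕ u + y ⊖ u + c) % n         ≡⟨ cong (_% n) (+-assoc (toℕ u) (y ⊖ u) c) ⟩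
      (toℕ u + (y ⊖ u + c)) % n       ≡⟨ cong (λ t → (toℕ u + t) % n) eq ⟩
      (toℕ u + x ⊖ u) % n             ≡⟨ ⊖-spec x u ⟩
      toℕ x                           ∎

  ⊖-flip : ∀ {x y} → x ≢ y → x ⊖ y + y ⊖ x ≡ n
  ⊖-flip {x} {y} x≢y = begin
    x ⊖ y + y ⊖ x         ≡⟨ cong (e +_) (⊖-unique {y} {x} reach n∸e<n) ⟩
    x ⊖ y + (n ∸ x ⊖ y)   ≡⟨ m+[n∸m]≡n e≤n ⟩
    n                     ∎
    where
    open ≡-Reasoning
    e = x ⊖ y
    e≤n : e ≤ n
    e≤n = <⇒≤ (⊖<n x y)
    n∸e<n : n ∸ e < n
    n∸e<n = ∸-monoʳ-< {o = 0} (⊖-pos x≢y) e≤n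
    reach : (toℕ x + (n ∸ e)) % n ≡ toℕ y
    reach = begin
      (toℕ x + (n ∸ e)) % n             ≡⟨ cong (λ t → (t + (n ∸ e)) % n) (⊖-spec x y) ⟨
      ((toℕ y + e) % n + (n ∸ e)) % n   ≡⟨ %-absorbˡ (toℕ y + e) (n ∸ e) ⟩
      (toℕ y + e + (n ∸ e)) % n         ≡⟨ cong (_% n) (+-assoc (toℕ y) e (n ∸ e)) ⟩
      (toℕ y + (e + (n ∸ e))) % n       ≡⟨ cong (λ t → (toℕ y + t) % n) (m+[n∸m]≡n e≤n) ⟩
      (toℕ y + n) % n                   ≡⟨ [m+n]%n≡m%n (toℕ y) n ⟩
      toℕ y % n                         ≡⟨ m<n⇒m%n≡m (Finₚ.toℕ<n y) ⟩
      toℕ y                             ∎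

  ⊖-⊕-below : ∀ u x {s} → s < n → s ≤ x ⊖ u → x ⊖ (u ⊕ s) + s ≡ x ⊖ u
  ⊖-⊕-below u x {s} s<n s≤o = begin
    x ⊖ (u ⊕ s) + s   ≡⟨ cong (_+ s) (⊖-rebase u from-u) ⟩
    x ⊖ u ∸ s + s     ≡⟨ m∸n+n≡m s≤o ⟩
    x ⊖ u             ∎
    where
    open ≡-Reasoning
    from-u : u ⊕ s ⊖ u + (x ⊖ u ∸ s) ≡ x ⊖ u
    from-u = trans (cong (_+ (x ⊖ u ∸ s)) (⊕-⊖ u s<n)) (m+[n∸m]≡n s≤o)

  ⊖-⊕-above : ∀ u x {s} → s < n → x ⊖ u < s → x ⊖ (u ⊕ s) + s ≡ x ⊖ u + n
  ⊖-⊕-above u x {s} s<n o<s = begin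
    x ⊖ (u ⊕ s) + s                     ≡⟨ cong (x ⊖ (u ⊕ s) +_) (m∸n+n≡m (<⇒≤ o<s)) ⟨
    x ⊖ (u ⊕ s) + (s ∸ x ⊖ u + x ⊖ u)   ≡⟨ +-assoc (x ⊖ (u ⊕ s)) _ (x ⊖ u) ⟨
    x ⊖ (u ⊕ s) + (s ∸ x ⊖ u) + x ⊖ u   ≡⟨ cong (λ t → x ⊖ (u ⊕ s) + t + x ⊖ u) back ⟨
    x ⊖ (u ⊕ s) + (u ⊕ s) ⊖ x + x ⊖ u   ≡⟨ cong (_+ x ⊖ u) (⊖-flip x≢u⊕s) ⟩
    n + x ⊖ u                           ≡⟨ +-comm n (x ⊖ u) ⟩
    x ⊖ u + n                           ∎
    where
    open ≡-Reasoning
    back : (u ⊕ s) ⊖ x ≡ s ∸ x ⊖ u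
    back = ⊖-rebase u (trans (m+[n∸m]≡n (<⇒≤ o<s)) (sym (⊕-⊖ u s<n)))
    x≢u⊕s : x ≢ u ⊕ s
    x≢u⊕s refl = <⇒≢ (m<n⇒0<n∸m o<s) (sym (trans (sym back) (⊖-self (u ⊕ s))))

-- Circulant graphs

record Compatible (Q : ℕ → Set) (d x y : ℕ) : Set where
  constructor compatible
  field
    gap     : ℕ
    x+gap≡y : x + gap ≡ y
    gap-ok  : Q gap ⊎ (x ≡ 0 × y ≡ d)

record CompatibleOffsets (Q : ℕ → Set) (n d s : ℕ) : Set where
  constructor offsets
  field
    elems    : List ℕ
    length≡  : length elems ≡ s
    below    : All (_< n) elems
    pairwise : AllPairs (Compatible Q d) elems

module Circulant (m : ℕ) {P : ℕ → Set} (P? : Decidable P)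
                 (P-reflect : ∀ {d e} → d + e ≡ suc m → P d → P e) (¬P0 : ¬ P 0) where

  open Cyclic m public

  circulant : Graph n
  circulant = record
    { adj    = λ x y → does (P? (x ⊖ y))
    ; sym    = adj-sym
    ; irrefl = λ x → trans (cong (does ∘ P?) (⊖-self x)) (dec-false (P? 0) ¬P0)
    }
    where
    adj-sym : ∀ x y → does (P? (x ⊖ y)) ≡ does (P? (y ⊖ x))
    adj-sym x y with x Fin.≟ y
    ... | yes refl = refl
    ... | no x≢y   = does-⇔ (mk⇔ (P-reflect (⊖-flip x≢y))
                                 (P-reflect (trans (+-comm (y ⊖ x) (x ⊖ y)) (⊖-flip x≢y))))
                             (P? _) (P? _)

  adj-offsets : ∀ u x y → adj circulant x y ≡ does (P? ∣ x ⊖ u - y ⊖ u ∣)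
  adj-offsets u x y with ≤-total (y ⊖ u) (x ⊖ u)
  ... | inj₁ y≤x = cong (does ∘ P?)
    (trans (⊖-rebase u (m+[n∸m]≡n y≤x)) (sym (m≤n⇒∣n-m∣≡n∸m y≤x)))
  ... | inj₂ x≤y = trans (Graph.sym circulant x y) (cong (does ∘ P?)
    (trans (⊖-rebase u (m+[n∸m]≡n x≤y)) (sym (m≤n⇒∣m-n∣≡n∸m x≤y))))

  homogeneous-offsets : ∀ u v (u≢v : u ≢ v) b {Q : ℕ → Set} →
    (∀ {c} → Q c → does (P? c) ≡ b) → (∀ {c} → Q c → 0 < c) → ∀ {s} →
    CompatibleOffsets Q n (v ⊖ u) s → Homogeneous (setPair circulant u v u≢v b) b s
  homogeneous-offsets u v u≢v b {Q} Q⇒adj Q⇒pos (offsets xs refl below pairwise) =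
    subst (Homogeneous H b) (length-map (u ⊕_) xs)
      (homogeneous-fromList H b (map (u ⊕_) xs)
        (AllPairsₚ.map⁺ (AllPairs.map homogeneous-pair (AllPairs-withAll below pairwise))))
    where
    H : Graph n
    H = setPair circulant u v u≢v b

    distinct : ∀ {x y} → x < y → y < n → u ⊕ x ≢ u ⊕ y
    distinct x<y y<n eq = <-irrefl (⊕-injectiveʳ u (<-trans x<y y<n) y<n eq) x<y

    homogeneous-pair : ∀ {x y} → Compatible Q (v ⊖ u) x y × y < n →
                       HomogeneousPair H b (u ⊕ x) (u ⊕ y)
    homogeneous-pair {x} {y} (compatible c x+c≡y (inj₁ q) , y<n) =
      distinct x<y y<n ,
      setPair-adj-≡ circulant u v b u≢v
        (trans (adj-offsets u (u ⊕ x) (u ⊕ y)) (trans (cong (does ∘ P?) gap) (Q⇒adj q)))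
      where
      open ≡-Reasoning
      x<y : x < y
      x<y = subst (x <_) x+c≡y (m<m+n x (Q⇒pos q))
      gap : ∣ u ⊕ x ⊖ u - u ⊕ y ⊖ u ∣ ≡ c
      gap = begin
        ∣ u ⊕ x ⊖ u - u ⊕ y ⊖ u ∣ ≡⟨ cong₂ ∣_-_∣ (⊕-⊖ u (<-trans x<y y<n)) (⊕-⊖ u y<n) ⟩
        ∣ x - y ∣                 ≡⟨ cong (∣ x -_∣) x+c≡y ⟨
        ∣ x - x + c ∣             ≡⟨ ∣m-m+n∣≡n x c ⟩
        c                         ∎
    homogeneous-pair (compatible _ _ (inj₂ (refl , refl)) , y<n) =
      distinct (⊖-pos (u≢v ∘ sym)) y<n ,
      subst₂ (λ s t → adj H s t ≡ b) (sym u⊕0≡u) (sym (⊖-⊕ u v))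
        (setPair-adj-pair circulant u v b u≢v)
      where
      u⊕0≡u : u ⊕ 0 ≡ u
      u⊕0≡u = trans (cong (u ⊕_) (sym (⊖-self u))) (⊖-⊕ u u)

  homogeneous-from-either-end : ∀ u v (u≢v : u ≢ v) b {Q : ℕ → Set} →
    (∀ {c} → Q c → does (P? c) ≡ b) → (∀ {c} → Q c → 0 < c) → ∀ {s} →
    CompatibleOffsets Q n (v ⊖ u) s ⊎ CompatibleOffsets Q n (u ⊖ v) s →
    Homogeneous (setPair circulant u v u≢v b) b s
  homogeneous-from-either-end u v u≢v b Q⇒adj Q⇒pos (inj₁ from-u) =
    homogeneous-offsets u v u≢v b Q⇒adj Q⇒pos from-u
  homogeneous-from-either-end u v u≢v b Q⇒adj Q⇒pos (inj₂ from-v) =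
    homogeneous-setPair-comm circulant u v b u≢v (u≢v ∘ sym)
      (homogeneous-offsets v u (u≢v ∘ sym) b Q⇒adj Q⇒pos from-v)

-- Offset sets as unions of intervals

Block : Set
Block = ℕ × ℕ

interval : Block → List ℕ
interval (s , L) = applyUpTo (s +_) L

length-blocks : ∀ bs → length (concatMap interval bs) ≡ sum (map proj₂ bs)
length-blocks []             = refl
length-blocks ((s , L) ∷ bs) = begin
  length (interval (s , L) ++ concatMap interval bs)
    ≡⟨ length-++ (interval (s , L)) ⟩
  length (interval (s , L)) + length (concatMap interval bs)
    ≡⟨ cong₂ _+_ (length-applyUpTo (s +_) L) (length-blocks bs) ⟩
  L + sum (map proj₂ bs)
    ∎
  where open ≡-Reasoning

module _ {Q : ℕ → Set} {d : ℕ} where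

  record Inner (b : Block) : Set where
    constructor inner
    field
      compatible-inner : ∀ {i j} → i < j → j < proj₂ b →
                         Compatible Q d (proj₁ b + i) (proj₁ b + j)

  record Cross (b b′ : Block) : Set where
    constructor cross
    field
      compatible-cross : ∀ {i j} → i < proj₂ b → j < proj₂ b′ →
                         Compatible Q d (proj₁ b + i) (proj₁ b′ + j)

  fromBlocks : ∀ {n s} bs → All (λ (s , L) → s + L ≤ n) bs → All Inner bs → AllPairs Cross bs →
               sum (map proj₂ bs) ≡ s → CompatibleOffsets Q n d s
  fromBlocks {n} bs below inners crosses size = offsets
    (concatMap interval bs)
    (trans (length-blocks bs) size)
    (Allₚ.concat⁺ (Allₚ.map⁺ (All.map below⇒ below)))
    (AllPairsₚ.concat⁺ (Allₚ.map⁺ (All.map inner⇒ inners))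
                       (AllPairsₚ.map⁺ (AllPairs.map cross⇒ crosses)))
    where
    below⇒ : ∀ {b} → proj₁ b + proj₂ b ≤ n → All (_< n) (interval b)
    below⇒ {s , L} s+L≤n =
      Allₚ.applyUpTo⁺₁ (s +_) L (λ i<L → <-≤-trans (+-monoʳ-< s i<L) s+L≤n)
    inner⇒ : ∀ {b} → Inner b → AllPairs (Compatible Q d) (interval b)
    inner⇒ {s , L} (inner p) = AllPairsₚ.applyUpTo⁺₁ (s +_) L p
    cross⇒ : ∀ {b b′} → Cross b b′ →
             All (λ x → All (Compatible Q d x) (interval b′)) (interval b)
    cross⇒ {s , L} {s′ , L′} (cross p) =
      Allₚ.applyUpTo⁺₁ (s +_) L (λ i<L → Allₚ.applyUpTo⁺₁ (s′ +_) L′ (p i<L))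

  inner-singleton : ∀ {s} → Inner (s , 1)
  inner-singleton = inner λ { i<j (s≤s z≤n) → ⊥-elim (n≮0 i<j) }

  inner-range : ∀ {s L ℓ} → (∀ {c} → 0 < c → c < ℓ → Q c) → L ≤ ℓ → Inner (s , L)
  inner-range {s} q L≤ℓ = inner λ {i} {j} i<j j<L →
    compatible (j ∸ i) (trans (+-assoc s i (j ∸ i)) (cong (s +_) (m+[n∸m]≡n (<⇒≤ i<j))))
      (inj₁ (q (m<n⇒0<n∸m i<j) (≤-<-trans (m∸n≤m j i) (<-≤-trans j<L L≤ℓ))))

  cross-range : ∀ {lo hi s L s′ L′} → (∀ {c} → lo < c → c < hi → Q c) →
                lo + (s + L) ≤ s′ → s′ + L′ ≤ s + hi → Cross (s , L) (s′ , L′)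
  cross-range {lo} {hi} {s} {L} {s′} {L′} q lower upper = cross compatible-pair
    where
    compatible-pair : ∀ {i j} → i < L → j < L′ → Compatible Q d (s + i) (s′ + j)
    compatible-pair {i} {j} i<L j<L′ = compatible (s′ + j ∸ (s + i)) x+c≡y
      (inj₁ (q (+-cancelˡ-< (s + i) lo _ (subst (s + i + lo <_) (sym x+c≡y) x+lo<y))
               (+-cancelˡ-< (s + i) _ hi (subst (_< s + i + hi) (sym x+c≡y) y<x+hi))))
      where
      open ≤-Reasoning
      x+lo<y : s + i + lo < s′ + j
      x+lo<y = begin-strict
        s + i + lo      <⟨ +-monoˡ-< lo (+-monoʳ-< s i<L) ⟩
        s + L + lo      ≡⟨ +-comm (s + L) lo ⟩
        lo + (s + L)    ≤⟨ lower ⟩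
        s′              ≤⟨ m≤m+n s′ j ⟩
        s′ + j          ∎
      y<x+hi : s′ + j < s + i + hi
      y<x+hi = begin-strict
        s′ + j          <⟨ +-monoʳ-< s′ j<L′ ⟩
        s′ + L′         ≤⟨ upper ⟩
        s + hi          ≤⟨ +-monoˡ-≤ hi (m≤m+n s i) ⟩
        s + i + hi      ∎
      x+c≡y : s + i + (s′ + j ∸ (s + i)) ≡ s′ + j
      x+c≡y = m+[n∸m]≡n (≤-trans (m≤m+n (s + i) lo) (<⇒≤ x+lo<y))

  cross-single : ∀ {s s′ c} → Q c → s + c ≡ s′ → Cross (s , 1) (s′ , 1)
  cross-single {s} {s′} {c} q eq = cross λ { (s≤s z≤n) (s≤s z≤n) →
    compatible c (trans (cong (_+ c) (+-identityʳ s)) (trans eq (sym (+-identityʳ s′)))) (inj₁ q) }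

  cross-special : Cross (0 , 1) (d , 1)
  cross-special = cross λ { (s≤s z≤n) (s≤s z≤n) →
    compatible d (sym (+-identityʳ d)) (inj₂ (refl , +-identityʳ d)) }

≤-by : ∀ {a b} c → a + c ≡ b → a ≤ b
≤-by {a} c refl = m≤m+n a c

-- The connection set {k, −k} ∪ [2k + 1, 4k] of ℤ/(6k+1); backward is −k = 5k + 1.
data Conn (k : ℕ) : ℕ → Set where
  forward  : Conn k k
  backward : Conn k (suc (5 * k))
  middle   : ∀ {d} → 2 * k < d → d ≤ 4 * k → Conn k d

conn? : ∀ k → Decidable (Conn k)
conn? k d with d ≟ k | d ≟ suc (5 * k) | 2 * k <? d | d ≤? 4 * k
... | yes refl | _        | _      | _      = yes forward
... | no _     | yes refl | _      | _      = yes backward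
... | no _     | no _     | yes lo | yes hi = yes (middle lo hi)
... | no d≢k   | no d≢-k  | no ¬lo | _      =
  no λ { forward → d≢k refl ; backward → d≢-k refl ; (middle lo _) → ¬lo lo }
... | no d≢k   | no d≢-k  | _      | no ¬hi =
  no λ { forward → d≢k refl ; backward → d≢-k refl ; (middle _ hi) → ¬hi hi }

-- Variable lists for the ring solver are written with L.∷ and L.[]: with the All/AllPairs
-- constructors also in scope, the overloaded ones make the solve macro loop.
Conn-reflect : ∀ {k d e} → d + e ≡ suc (6 * k) → Conn k d → Conn k e
Conn-reflect {k} {e = e} d+e≡n forward = subst (Conn k) (+-cancelˡ-≡ k (suc (5 * k)) e (begin
  k + suc (5 * k)   ≡⟨ solve (k L.∷ L.[]) ⟩
  suc (6 * k)       ≡⟨ d+e≡n ⟨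
  k + e             ∎)) backward
  where open ≡-Reasoning
Conn-reflect {k} {e = e} d+e≡n backward = subst (Conn k) (+-cancelˡ-≡ (suc (5 * k)) k e (begin
  suc (5 * k) + k   ≡⟨ solve (k L.∷ L.[]) ⟩
  suc (6 * k)       ≡⟨ d+e≡n ⟨
  suc (5 * k) + e   ∎)) forward
  where open ≡-Reasoning
Conn-reflect {k} {d} {e} d+e≡n (middle lo hi) = middle
  (+-cancelˡ-≤ (4 * k) (suc (2 * k)) e (begin
    4 * k + suc (2 * k)   ≡⟨ solve (k L.∷ L.[]) ⟩
    suc (6 * k)           ≡⟨ d+e≡n ⟨
    d + e                 ≤⟨ +-monoˡ-≤ e hi ⟩
    4 * k + e             ∎))
  (+-cancelˡ-≤ (suc (2 * k)) e (4 * k) (begin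
    suc (2 * k) + e       ≤⟨ +-monoˡ-≤ e lo ⟩
    d + e                 ≡⟨ d+e≡n ⟩
    suc (6 * k)           ≡⟨ solve (k L.∷ L.[]) ⟩
    suc (2 * k) + 4 * k   ∎))
  where open ≤-Reasoning

Conn⇒≥ : ∀ {k d} → Conn k d → k ≤ d
Conn⇒≥ forward           = ≤-refl
Conn⇒≥ {k} backward      = ≤-by (suc (4 * k)) (solve (k L.∷ L.[]))
Conn⇒≥ {k} (middle lo _) = ≤-trans (≤-by {b = 2 * k} k (solve (k L.∷ L.[]))) (<⇒≤ lo)

Conn⇒≤ : ∀ {k d} → Conn k d → d ≤ suc (5 * k)
Conn⇒≤ {k} forward       = ≤-by {k} (suc (4 * k)) (solve (k L.∷ L.[]))
Conn⇒≤ backward          = ≤-refl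
Conn⇒≤ {k} (middle _ hi) = ≤-trans hi (≤-by {4 * k} (suc k) (solve (k L.∷ L.[])))

Conn⇒pos : ∀ {k d} → 0 < k → Conn k d → 0 < d
Conn⇒pos 0<k conn = <-≤-trans 0<k (Conn⇒≥ conn)

forward-or-big : ∀ {k d} → Conn k d → d ≡ k ⊎ 2 * k < d
forward-or-big forward       = inj₁ refl
forward-or-big {k} backward  = inj₂ (s≤s (≤-by (3 * k) (solve (k L.∷ L.[]))))
forward-or-big (middle lo _) = inj₂ lo

¬Conn : ∀ {k c} → c ≢ k → c ≢ suc (5 * k) → c ≤ 2 * k ⊎ 4 * k < c → ¬ Conn k c
¬Conn c≢k _ _ forward               = c≢k refl
¬Conn _ c≢-k _ backward             = c≢-k refl
¬Conn _ _ (inj₁ c≤2k) (middle lo _) = <⇒≱ lo c≤2k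
¬Conn _ _ (inj₂ 4k<c) (middle _ hi) = <⇒≱ 4k<c hi

¬Conn⇒outside : ∀ {k c} → ¬ Conn k c → c ≤ 2 * k ⊎ 4 * k < c
¬Conn⇒outside {k} {c} ¬conn with c ≤? 2 * k | 4 * k <? c
... | yes c≤2k | _       = inj₁ c≤2k
... | no _     | yes 4k<c = inj₂ 4k<c
... | no c≰2k  | no 4k≮c = ⊥-elim (¬conn (middle (≰⇒> c≰2k) (≮⇒≥ 4k≮c)))

¬Conn-0 : ∀ {k} → 0 < k → ¬ Conn k 0
¬Conn-0 0<k = ¬Conn (<⇒≢ 0<k) (λ ()) (inj₁ z≤n)

¬Conn-double : ∀ {k} → 0 < k → ¬ Conn k (k + k)
¬Conn-double {k} 0<k = ¬Conn
  (λ k+k≡k → <⇒≢ 0<k (sym (+-cancelˡ-≡ k k 0 (trans k+k≡k (sym (+-identityʳ k))))))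
  (<⇒≢ (s≤s (≤-by {k + k} {5 * k} (3 * k) (solve (k L.∷ L.[])))))
  (inj₁ (≤-reflexive (solve (k L.∷ L.[]))))

NonEdge : ℕ → ℕ → Set
NonEdge k c = 0 < c × ¬ Conn k c

short-gap : ∀ {k c} → 0 < c → c < k → NonEdge k c
short-gap {k} {c} 0<c c<k = 0<c , ¬Conn (<⇒≢ c<k)
  (<⇒≢ (<-≤-trans c<k (≤-by {k} {suc (5 * k)} (suc (4 * k)) (solve (k L.∷ L.[])))))
  (inj₁ (≤-trans (<⇒≤ c<k) (≤-by {k} {2 * k} k (solve (k L.∷ L.[])))))

mid-gap : ∀ {k c} → k < c → c < suc (2 * k) → NonEdge k c
mid-gap {k} {c} k<c c≤2k = ≤-<-trans z≤n k<c , ¬Conn (>⇒≢ k<c)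
  (<⇒≢ (≤-<-trans (s≤s⁻¹ c≤2k) (s≤s (≤-by {2 * k} {5 * k} (3 * k) (solve (k L.∷ L.[]))))))
  (inj₁ (s≤s⁻¹ c≤2k))

long-gap : ∀ {k c} → 4 * k < c → c < suc (5 * k) → NonEdge k c
long-gap {k} {c} 4k<c c≤5k = ≤-<-trans z≤n 4k<c ,
  ¬Conn (>⇒≢ (≤-<-trans (≤-by {k} {4 * k} (3 * k) (solve (k L.∷ L.[]))) 4k<c))
        (<⇒≢ c≤5k) (inj₂ 4k<c)

-- The upper bound is vacuous for offsets below 6k + 1; it only gives the lemma the interval
-- shape that cross-range expects.
wrap-gap : ∀ {k c} → suc (5 * k) < c → c < suc (6 * k) → NonEdge k c
wrap-gap {k} {c} 5k+1<c _ = ≤-<-trans z≤n 5k+1<c ,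
  ¬Conn (>⇒≢ (<-trans (s≤s (≤-by {k} {5 * k} (4 * k) (solve (k L.∷ L.[])))) 5k+1<c)) (>⇒≢ 5k+1<c)
    (inj₂ (<-trans (s≤s (≤-by {4 * k} {5 * k} k (solve (k L.∷ L.[])))) 5k+1<c))

middle-edge : ∀ {k c} → 2 * k < c → c < suc (4 * k) → Conn k c
middle-edge lo hi = middle lo (s≤s⁻¹ hi)

-- No K₄

big-beside-forward : ∀ {k y} → 0 < k → Conn k y → Conn k (k + y) → 2 * k < y
big-beside-forward 0<k conn-y conn-k+y with forward-or-big conn-y
... | inj₁ refl = ⊥-elim (¬Conn-double 0<k conn-k+y)
... | inj₂ big  = big

sum-exceeds : ∀ {x y z w a b c d N} → a ≤ x → b ≤ y → c ≤ z → d ≤ w → N < a + b + c + d →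
              x + y + z + w ≢ N
sum-exceeds a≤x b≤y c≤z d≤w N<sum eq =
  <⇒≱ N<sum (subst (_ ≤_) eq (+-mono-≤ (+-mono-≤ (+-mono-≤ a≤x b≤y) c≤z) d≤w))

no-connected-arcs : ∀ {k x y z w} → 0 < k →
  Conn k x → Conn k y → Conn k z → Conn k w → Conn k (x + y) → Conn k (y + z) → Conn k (w + x) →
  x + y + z + w ≢ suc (6 * k)
no-connected-arcs {k} {x} {y} {z} {w} 0<k cx cy cz cw cxy cyz cwx with forward-or-big cx | forward-or-big cy
... | inj₁ refl  | _          = sum-exceeds {N = suc (6 * k)}
  (≤-refl {k}) (big-beside-forward 0<k cy cxy) (Conn⇒≥ cz)
  (big-beside-forward 0<k cw (subst (Conn k) (+-comm w k) cwx)) (≤-reflexive (solve (k L.∷ L.[])))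
... | inj₂ x-big | inj₁ refl  = sum-exceeds {N = suc (6 * k)}
  x-big (≤-refl {k}) (big-beside-forward 0<k cz cyz) (Conn⇒≥ cw) (≤-reflexive (solve (k L.∷ L.[])))
... | inj₂ x-big | inj₂ y-big = sum-exceeds {N = suc (6 * k)}
  x-big y-big (Conn⇒≥ cz) (Conn⇒≥ cw) (≤-reflexive (solve (k L.∷ L.[])))

-- Offsets a, b, c of three vertices of a K₄ from the fourth one.
record ConnClique (k a b c : ℕ) : Set where
  field
    conn-a  : Conn k a
    conn-b  : Conn k b
    conn-c  : Conn k c
    conn-ab : Conn k ∣ a - b ∣
    conn-bc : Conn k ∣ b - c ∣
    conn-ac : Conn k ∣ a - c ∣

ConnClique-swap₁₂ : ∀ {k a b c} → ConnClique k a b c → ConnClique k b a c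
ConnClique-swap₁₂ {k} {a} {b} p = record
  { conn-a = conn-b ; conn-b = conn-a ; conn-c = conn-c
  ; conn-ab = subst (Conn k) (∣-∣-comm a b) conn-ab ; conn-bc = conn-ac ; conn-ac = conn-bc }
  where open ConnClique p

ConnClique-swap₂₃ : ∀ {k a b c} → ConnClique k a b c → ConnClique k a c b
ConnClique-swap₂₃ {k} {b = b} {c} p = record
  { conn-a = conn-a ; conn-b = conn-c ; conn-c = conn-b
  ; conn-ab = conn-ac ; conn-bc = subst (Conn k) (∣-∣-comm b c) conn-bc ; conn-ac = conn-ab }
  where open ConnClique p

wlog-sorted : ∀ {P : ℕ → ℕ → ℕ → Set} →
  (∀ {a b c} → P a b c → P b a c) → (∀ {a b c} → P a b c → P a c b) →
  (∀ {a b c} → a < b → b < c → ¬ P a b c) →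
  ∀ {a b c} → a ≢ b → b ≢ c → a ≢ c → ¬ P a b c
wlog-sorted swap₁₂ swap₂₃ sorted {a} {b} {c} a≢b b≢c a≢c p with <-cmp a b | <-cmp b c | <-cmp a c
... | tri≈ _ a≡b _ | _            | _            = a≢b a≡b
... | _            | tri≈ _ b≡c _ | _            = b≢c b≡c
... | _            | _            | tri≈ _ a≡c _ = a≢c a≡c
... | tri< a<b _ _ | tri< b<c _ _ | _            = sorted a<b b<c p
... | tri< a<b _ _ | tri> _ _ c<b | tri< a<c _ _ = sorted a<c c<b (swap₂₃ p)
... | tri< a<b _ _ | tri> _ _ c<b | tri> _ _ c<a = sorted c<a a<b (swap₁₂ (swap₂₃ p))
... | tri> _ _ b<a | tri< b<c _ _ | tri< a<c _ _ = sorted b<a a<c (swap₁₂ p)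
... | tri> _ _ b<a | tri< b<c _ _ | tri> _ _ c<a = sorted b<c c<a (swap₂₃ (swap₁₂ p))
... | tri> _ _ b<a | tri> _ _ c<b | _            = sorted c<b b<a (swap₁₂ (swap₂₃ (swap₁₂ p)))

no-sorted-ConnClique : ∀ {k a b c} → 0 < k → a < b → b < c → ¬ ConnClique k a b c
no-sorted-ConnClique {k} {a} 0<k a<b b<c p
  with y , refl  ← m≤n⇒∃[o]m+o≡n (<⇒≤ a<b)
     | z , refl  ← m≤n⇒∃[o]m+o≡n (<⇒≤ b<c)
     | w , total ← m≤n⇒∃[o]m+o≡n (≤-trans (Conn⇒≤ (ConnClique.conn-c p))
                                           (≤-by {suc (5 * k)} {suc (6 * k)} k (solve (k L.∷ L.[]))))
  = no-connected-arcs 0<k conn-a conn-y conn-z conn-w conn-b conn-y+z conn-w+a total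
  where
  open ConnClique p
  conn-y : Conn k y
  conn-y = subst (Conn k) (∣m-m+n∣≡n a y) conn-ab
  conn-z : Conn k z
  conn-z = subst (Conn k) (∣m-m+n∣≡n (a + y) z) conn-bc
  conn-y+z : Conn k (y + z)
  conn-y+z = subst (Conn k) (trans (cong (∣ a -_∣) (+-assoc a y z)) (∣m-m+n∣≡n a (y + z))) conn-ac
  conn-w : Conn k w
  conn-w = Conn-reflect total conn-c
  conn-w+a : Conn k (w + a)
  conn-w+a = Conn-reflect (trans (rearrange a y z w) total) conn-y+z
    where
    rearrange : ∀ a y z w → y + z + (w + a) ≡ a + y + z + w
    rearrange a y z w = solve (a L.∷ y L.∷ z L.∷ w L.∷ L.[])

no-ConnClique : ∀ {k a b c} → 0 < k → a ≢ b → b ≢ c → a ≢ c → ¬ ConnClique k a b c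
no-ConnClique 0<k = wlog-sorted ConnClique-swap₁₂ ConnClique-swap₂₃ (no-sorted-ConnClique 0<k)

-- No independent set of size k + 2

-- On [0, 2k] the fibres of pair-class k are {c, c + k} (c < k) and {2k}.
pair-class : ℕ → ℕ → ℕ
pair-class k x with x <? k
... | yes _ = x
... | no _  = x ∸ k

pair-class-spec : ∀ k {x} → x ≤ 2 * k →
                  pair-class k x ≤ k × (x ≡ pair-class k x ⊎ x ≡ pair-class k x + k)
pair-class-spec k {x} x≤2k with x <? k
... | yes x<k = <⇒≤ x<k , inj₁ refl
... | no x≮k  = +-cancelʳ-≤ k (x ∸ k) k (begin
  x ∸ k + k   ≡⟨ m∸n+n≡m k≤x ⟩
  x           ≤⟨ x≤2k ⟩
  2 * k       ≡⟨ solve (k L.∷ L.[]) ⟩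
  k + k       ∎) , inj₂ (sym (m∸n+n≡m k≤x))
  where
  open ≤-Reasoning
  k≤x = ≮⇒≥ x≮k

window-pigeonhole : ∀ k (e : Fin (2 + k) → ℕ) → Injective _≡_ _≡_ e → (∀ i → e i ≤ 2 * k) →
                    ∃₂ λ i j → e i + k ≡ e j
window-pigeonhole k e e-inj bound = collide (Finₚ.pigeonhole ≤-refl class)
  where
  class<1+k : ∀ i → pair-class k (e i) < suc k
  class<1+k i = s≤s (proj₁ (pair-class-spec k (bound i)))
  class : Fin (2 + k) → Fin (suc k)
  class i = fromℕ< (class<1+k i)
  collide : ∃₂ (λ i j → i Fin.< j × class i ≡ class j) → ∃₂ λ i j → e i + k ≡ e j
  collide (i , j , i<j , same) =
    members (subst (λ c → e i ≡ c ⊎ e i ≡ c + k)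
                   (Finₚ.fromℕ<-injective _ _ (class<1+k i) (class<1+k j) same)
                   (proj₂ (pair-class-spec k (bound i))))
            (proj₂ (pair-class-spec k (bound j)))
    where
    i≢j : i ≢ j
    i≢j = Finₚ.<⇒≢ i<j
    members : ∀ {c} → e i ≡ c ⊎ e i ≡ c + k → e j ≡ c ⊎ e j ≡ c + k →
              ∃₂ λ i j → e i + k ≡ e j
    members (inj₁ ei≡c)   (inj₁ ej≡c)   = ⊥-elim (i≢j (e-inj (trans ei≡c (sym ej≡c))))
    members (inj₁ ei≡c)   (inj₂ ej≡c+k) = i , j , trans (cong (_+ k) ei≡c) (sym ej≡c+k)
    members (inj₂ ei≡c+k) (inj₁ ej≡c)   = j , i , trans (cong (_+ k) ej≡c) (sym ei≡c+k)
    members (inj₂ ei≡c+k) (inj₂ ej≡c+k) = ⊥-elim (i≢j (e-inj (trans ei≡c+k (sym ej≡c+k))))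

-- Opaque: unfolding argmin over allFin (2 + k) makes type checking blow up.
opaque
  Fin-argmin : ∀ {n} (f : Fin (suc n) → ℕ) → Σ (Fin (suc n)) λ m → ∀ i → f m ≤ f i
  Fin-argmin {n} f = argmin f Fin.zero (allFin (suc n)) ,
    λ i → All.lookup (f[argmin]≤f[xs] {f = f} Fin.zero (allFin (suc n))) (∈-allFin i)

gap-≤2k : ∀ {k a b} → b ≤ a → a ≤ 4 * k → (a ≢ b → ¬ Conn k (a ∸ b)) → a ∸ b ≤ 2 * k
gap-≤2k {k} {a} {b} b≤a a≤4k non-edge with a ≟ b
... | yes refl = subst (_≤ 2 * k) (sym (n∸n≡0 a)) z≤n
... | no a≢b with ¬Conn⇒outside (non-edge a≢b)
...   | inj₁ ≤2k = ≤2k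
...   | inj₂ 4k< = ⊥-elim (<⇒≱ 4k< (≤-trans (m∸n≤m a b) a≤4k))

no-independent-offsets : ∀ {k} → 0 < k → (q : Fin (2 + k) → ℕ) → Injective _≡_ _≡_ q →
  (∀ i → q i ≤ 4 * k) → (∀ i j → i ≢ j → ¬ Conn k ∣ q i - q j ∣) → ⊥
no-independent-offsets {k} 0<k q q-inj q≤4k apart with m , q-min ← Fin-argmin q =
  k-apart (window-pigeonhole k e e-inj e≤2k)
  where
  e : Fin (2 + k) → ℕ
  e i = q i ∸ q m
  e+min : ∀ i → e i + q m ≡ q i
  e+min i = m∸n+n≡m (q-min i)
  e-inj : Injective _≡_ _≡_ e
  e-inj {i} {j} eq = q-inj (∸-cancelʳ-≡ (q-min i) (q-min j) eq)
  e≤2k : ∀ i → e i ≤ 2 * k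
  e≤2k i = gap-≤2k (q-min i) (q≤4k i) λ qi≢qm →
    subst (λ d → ¬ Conn k d) (m≤n⇒∣n-m∣≡n∸m (q-min i)) (apart i m (qi≢qm ∘ cong q))
  k-apart : ∃₂ (λ i j → e i + k ≡ e j) → ⊥
  k-apart (i , j , ei+k≡ej) = apart i j i≢j (subst (Conn k) (sym ∣qi-qj∣≡k) forward)
    where
    open ≡-Reasoning
    i≢j : i ≢ j
    i≢j refl = <⇒≢ 0<k (sym (+-cancelˡ-≡ (e i) k 0 (trans ei+k≡ej (sym (+-identityʳ (e i))))))
    qj≡qi+k : q j ≡ q i + k
    qj≡qi+k = begin
      q j               ≡⟨ e+min j ⟨
      e j + q m         ≡⟨ cong (_+ q m) ei+k≡ej ⟨
      e i + k + q m     ≡⟨ +-assoc (e i) k (q m) ⟩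
      e i + (k + q m)   ≡⟨ cong (e i +_) (+-comm k (q m)) ⟩
      e i + (q m + k)   ≡⟨ +-assoc (e i) (q m) k ⟨
      e i + q m + k     ≡⟨ cong (_+ k) (e+min i) ⟩
      q i + k           ∎
    ∣qi-qj∣≡k : ∣ q i - q j ∣ ≡ k
    ∣qi-qj∣≡k = trans (cong (∣ q i -_∣) qj≡qi+k) (∣m-m+n∣≡n (q i) k)

-- Witnesses for saturation, as offsets from one end of the changed pair

-- Each set is listed by its blocks (start, length); the ≤-by arguments are the slacks of the
-- inequalities required by fromBlocks, inner-range and cross-range.

-- {0, d, 3k, 4k}
clique-offsets-short : ∀ {k d} → d < k → CompatibleOffsets (Conn k) (suc (6 * k)) d 4
clique-offsets-short {d = d} d<k with e , refl ← m≤n⇒∃[o]m+o≡n d<k =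
  let k = suc d + e
      vars = d L.∷ e L.∷ L.[] in
  fromBlocks ((0 , 1) ∷ (d , 1) ∷ (3 * k , 1) ∷ (4 * k , 1) ∷ [])
    (s≤s z≤n ∷ ≤-by (5 * k + suc e) (solve vars) ∷
     ≤-by (3 * k) (solve vars) ∷ ≤-by (2 * k) (solve vars) ∷ [])
    (inner-singleton ∷ inner-singleton ∷ inner-singleton ∷ inner-singleton ∷ [])
    ((cross-special ∷
      cross-range middle-edge (≤-by (d + e) (solve vars)) (≤-by k (solve vars)) ∷
      cross-range middle-edge (≤-by (k + d + e) (solve vars)) (≤-reflexive (solve vars)) ∷ []) ∷
     (cross-range middle-edge (≤-by e (solve vars)) (≤-by (k + d) (solve vars)) ∷
      cross-range middle-edge (≤-by (k + e) (solve vars)) (≤-by d (solve vars)) ∷ []) ∷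
     (cross-single forward (solve vars) ∷ []) ∷ [] ∷ [])
    refl

decompose-k<d≤2k : ∀ {k d} → k < d → d ≤ 2 * k →
                   ∃₂ λ a b → k ≡ suc (a + b) × d ≡ suc k + a
decompose-k<d≤2k {k} k<d d≤2k
  with a , refl ← m≤n⇒∃[o]m+o≡n k<d | b , d+b≡2k ← m≤n⇒∃[o]m+o≡n d≤2k =
  a , b , sym (+-cancelˡ-≡ k (suc (a + b)) k (begin
    k + suc (a + b)   ≡⟨ solve (k L.∷ a L.∷ b L.∷ L.[]) ⟩
    suc k + a + b     ≡⟨ d+b≡2k ⟩
    2 * k             ≡⟨ solve (k L.∷ L.[]) ⟩
    k + k             ∎)) , refl
  where open ≡-Reasoning

-- {0, d, d + k, 5k + 1}
clique-offsets-long : ∀ {k d} → k < d → d ≤ 2 * k → CompatibleOffsets (Conn k) (suc (6 * k)) d 4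
clique-offsets-long {k} k<d d≤2k with a , b , refl , refl ← decompose-k<d≤2k {k} k<d d≤2k =
  let k = suc (a + b)
      d = suc k + a
      vars = a L.∷ b L.∷ L.[] in
  fromBlocks ((0 , 1) ∷ (d , 1) ∷ (d + k , 1) ∷ (suc (5 * k) , 1) ∷ [])
    (s≤s z≤n ∷ ≤-by (4 * k + b) (solve vars) ∷ ≤-by (3 * k + b) (solve vars) ∷
     ≤-by (a + b) (solve vars) ∷ [])
    (inner-singleton ∷ inner-singleton ∷ inner-singleton ∷ inner-singleton ∷ [])
    ((cross-special ∷
      cross-range middle-edge (≤-by a (solve vars)) (≤-by (k + b) (solve vars)) ∷
      cross-single backward (solve vars) ∷ []) ∷
     (cross-single forward (solve vars) ∷
      cross-range middle-edge (≤-by (k + b) (solve vars)) (≤-by a (solve vars)) ∷ []) ∷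
     (cross-range middle-edge (≤-by b (solve vars)) (≤-by (k + a) (solve vars)) ∷ []) ∷ [] ∷ [])
    refl

-- {0} ∪ [1, k - 1) ∪ {k, 2k - 1, 6k}
independent-offsets-forward : ∀ {k} → 2 ≤ k → CompatibleOffsets (NonEdge k) (suc (6 * k)) k (2 + k)
independent-offsets-forward 2≤k with k′ , refl ← m≤n⇒∃[o]m+o≡n 2≤k =
  let k = 2 + k′
      vars = k′ L.∷ L.[]
      size : 1 + (k′ + 3) ≡ 2 + k
      size = solve vars in
  fromBlocks ((0 , 1) ∷ (1 , k′) ∷ (k , 1) ∷ (k + suc k′ , 1) ∷ (6 * k , 1) ∷ [])
    (s≤s z≤n ∷ ≤-by (5 * k + 2) (solve vars) ∷ ≤-by (5 * k) (solve vars) ∷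
     ≤-by (4 * k + 1) (solve vars) ∷ ≤-reflexive (solve vars) ∷ [])
    (inner-singleton ∷ inner-range short-gap (≤-by 2 (solve vars)) ∷
     inner-singleton ∷ inner-singleton ∷ inner-singleton ∷ [])
    ((cross-range short-gap ≤-refl (≤-by 1 (solve vars)) ∷
      cross-special ∷
      cross-range mid-gap (≤-by k′ (solve vars)) (≤-by 1 (solve vars)) ∷
      cross-range wrap-gap (≤-by k′ (solve vars)) (≤-reflexive (solve vars)) ∷ []) ∷
     (cross-range short-gap (≤-by 1 (solve vars)) (≤-reflexive (solve vars)) ∷
      cross-range mid-gap (≤-reflexive (solve vars)) (≤-by 2 (solve vars)) ∷
      cross-range wrap-gap (≤-reflexive (solve vars)) (≤-by 1 (solve vars)) ∷ []) ∷
     (cross-range short-gap (≤-by k′ (solve vars)) (≤-reflexive (solve vars)) ∷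
      cross-range long-gap (≤-by (suc k′) (solve vars)) (≤-reflexive (solve vars)) ∷ []) ∷
     (cross-range long-gap (≤-reflexive (solve vars)) (≤-by (suc k′) (solve vars)) ∷ []) ∷ [] ∷ [])
    size

decompose-2k<d<3k : ∀ {k d} → 2 * k < d → d < 3 * k →
                    ∃₂ λ j r → k ≡ 2 + (j + r) × d ≡ suc (2 * k) + j
decompose-2k<d<3k {k} 2k<d d<3k
  with j , refl ← m≤n⇒∃[o]m+o≡n 2k<d | r , d+r≡3k ← m≤n⇒∃[o]m+o≡n d<3k =
  j , r , sym (+-cancelˡ-≡ (2 * k) (2 + (j + r)) k (begin
    2 * k + (2 + (j + r))       ≡⟨ solve (k L.∷ j L.∷ r L.∷ L.[]) ⟩
    suc (suc (2 * k) + j) + r   ≡⟨ d+r≡3k ⟩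
    3 * k                       ≡⟨ solve (k L.∷ L.[]) ⟩
    2 * k + k                   ∎)) , refl
  where open ≡-Reasoning

-- {0} ∪ [j + 1, k - 1] ∪ [k + 1, k + j] ∪ {2k, d}  where d = 2k + 1 + j
independent-offsets-middle : ∀ {k d} → 2 * k < d → d < 3 * k →
                             CompatibleOffsets (NonEdge k) (suc (6 * k)) d (2 + k)
independent-offsets-middle {k} 2k<d d<3k with j , r , refl , refl ← decompose-2k<d<3k {k} 2k<d d<3k =
  let k = 2 + (j + r)
      d = suc (2 * k) + j
      vars = j L.∷ r L.∷ L.[]
      size : 1 + (suc r + (j + 2)) ≡ 2 + k
      size = solve vars in
  fromBlocks ((0 , 1) ∷ (suc j , suc r) ∷ (suc k , j) ∷ (2 * k , 1) ∷ (d , 1) ∷ [])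
    (s≤s z≤n ∷ ≤-by (5 * k + 1) (solve vars) ∷ ≤-by (4 * k + 2 + r) (solve vars) ∷
     ≤-by (4 * k) (solve vars) ∷ ≤-by (3 * k + 1 + r) (solve vars) ∷ [])
    (inner-singleton ∷ inner-range short-gap (≤-by (suc j) (solve vars)) ∷
     inner-range short-gap (≤-by (2 + r) (solve vars)) ∷ inner-singleton ∷ inner-singleton ∷ [])
    ((cross-range short-gap (s≤s z≤n) (≤-reflexive (solve vars)) ∷
      cross-range mid-gap (≤-reflexive (solve vars)) (≤-by (2 + r) (solve vars)) ∷
      cross-range mid-gap (≤-by (suc (j + r)) (solve vars)) (≤-reflexive (solve vars)) ∷
      cross-special ∷ []) ∷
     (cross-range short-gap (≤-by 1 (solve vars)) (≤-reflexive (solve vars)) ∷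
      cross-range mid-gap (≤-reflexive (solve vars)) (≤-by (suc j) (solve vars)) ∷
      cross-range mid-gap (≤-by (suc j) (solve vars)) (≤-reflexive (solve vars)) ∷ []) ∷
     (cross-range short-gap (≤-by (suc r) (solve vars)) (≤-reflexive (solve vars)) ∷
      cross-range mid-gap (≤-reflexive (solve vars)) (≤-by (2 + r) (solve vars)) ∷ []) ∷
     (cross-range short-gap (≤-by j (solve vars)) (≤-by r (solve vars)) ∷ []) ∷ [] ∷ [])
    size

-- {0, 3k} ∪ [4k + 1, 5k]
independent-offsets-3k : ∀ {k} → CompatibleOffsets (NonEdge k) (suc (6 * k)) (3 * k) (2 + k)
independent-offsets-3k {k} =
  let vars = k L.∷ L.[]
      size : 2 + (k + 0) ≡ 2 + k
      size = solve vars in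
  fromBlocks ((0 , 1) ∷ (3 * k , 1) ∷ (suc (4 * k) , k) ∷ [])
    (s≤s z≤n ∷ ≤-by (3 * k) (solve vars) ∷ ≤-by k (solve vars) ∷ [])
    (inner-singleton ∷ inner-singleton ∷ inner-range short-gap ≤-refl ∷ [])
    ((cross-special ∷
      cross-range long-gap (≤-reflexive (solve vars)) (≤-reflexive (solve vars)) ∷ []) ∷
     (cross-range mid-gap (≤-reflexive (solve vars)) (≤-reflexive (solve vars)) ∷ []) ∷ [] ∷ [])
    size

clique-offsets : ∀ {k d} → ¬ Conn k d → d ≤ 2 * k → CompatibleOffsets (Conn k) (suc (6 * k)) d 4
clique-offsets {k} {d} ¬conn d≤2k with <-cmp d k
... | tri< d<k _ _ = clique-offsets-short d<k
... | tri≈ _ refl _ = ⊥-elim (¬conn forward)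
... | tri> _ _ k<d = clique-offsets-long k<d d≤2k

independent-offsets : ∀ {k d} → 2 ≤ k → Conn k d → d ≤ 3 * k →
                      CompatibleOffsets (NonEdge k) (suc (6 * k)) d (2 + k)
independent-offsets 2≤k forward _ = independent-offsets-forward 2≤k
independent-offsets {k} _ backward 5k+1≤3k =
  ⊥-elim (<⇒≱ (s≤s (≤-by {3 * k} {5 * k} (2 * k) (solve (k L.∷ L.[])))) 5k+1≤3k)
independent-offsets {k} {d} _ (middle 2k<d _) d≤3k with <-cmp d (3 * k)
... | tri< d<3k _ _ = independent-offsets-middle 2k<d d<3k
... | tri≈ _ refl _ = independent-offsets-3k
... | tri> _ _ d>3k = ⊥-elim (<⇒≱ d>3k d≤3k)

complement-≤ : ∀ {d e m b} → d + e ≡ suc (m + b) → m < d → e ≤ b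
complement-≤ {d} {e} {m} {b} sum m<d = +-cancelˡ-≤ (suc m) e b (begin
  suc m + e     ≤⟨ +-monoˡ-≤ e m<d ⟩
  d + e         ≡⟨ sum ⟩
  suc (m + b)   ∎)
  where open ≤-Reasoning

clique-offsets-either : ∀ {k d e} → d + e ≡ suc (6 * k) → ¬ Conn k d →
  CompatibleOffsets (Conn k) (suc (6 * k)) d 4 ⊎ CompatibleOffsets (Conn k) (suc (6 * k)) e 4
clique-offsets-either {k} {d} {e} d+e≡n ¬conn with ¬Conn⇒outside ¬conn
... | inj₁ d≤2k = inj₁ (clique-offsets ¬conn d≤2k)
... | inj₂ 4k<d = inj₂ (clique-offsets (¬conn ∘ Conn-reflect (trans (+-comm e d) d+e≡n))
  (complement-≤ {m = 4 * k} {b = 2 * k} (trans d+e≡n (solve (k L.∷ L.[]))) 4k<d))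

independent-offsets-either : ∀ {k d e} → 2 ≤ k → d + e ≡ suc (6 * k) → Conn k d →
  CompatibleOffsets (NonEdge k) (suc (6 * k)) d (2 + k) ⊎
  CompatibleOffsets (NonEdge k) (suc (6 * k)) e (2 + k)
independent-offsets-either {k} {d} 2≤k d+e≡n conn with d ≤? 3 * k
... | yes d≤3k = inj₁ (independent-offsets 2≤k conn d≤3k)
... | no d≰3k  = inj₂ (independent-offsets 2≤k (Conn-reflect d+e≡n conn)
  (complement-≤ {m = 3 * k} {b = 3 * k} (trans d+e≡n (solve (k L.∷ L.[]))) (≰⇒> d≰3k)))

module ExtremalGraph (k : ℕ) (0<k : 0 < k) where

  open Circulant (6 * k) (conn? k) Conn-reflect (¬Conn-0 0<k) public

  G : Graph n
  G = circulant

  adjacent⇒Conn : ∀ u {x y} → adj G x y ≡ true → Conn k ∣ x ⊖ u - y ⊖ u ∣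
  adjacent⇒Conn u {x} {y} eq = does≡true⇒ (conn? k _) (trans (sym (adj-offsets u x y)) eq)

  nonadjacent⇒¬Conn : ∀ u {x y} → adj G x y ≡ false → ¬ Conn k ∣ x ⊖ u - y ⊖ u ∣
  nonadjacent⇒¬Conn u {x} {y} eq = does≡false⇒ (conn? k _) (trans (sym (adj-offsets u x y)) eq)

  K₄-free : ¬ HasClique G 4
  K₄-free (f , f-inj , clique) =
    no-ConnClique 0<k (apart 1F 2F λ ()) (apart 2F 3F λ ()) (apart 1F 3F λ ()) record
      { conn-a  = from-0 1F λ () ; conn-b  = from-0 2F λ () ; conn-c  = from-0 3F λ ()
      ; conn-ab = conn 1F 2F λ () ; conn-bc = conn 2F 3F λ () ; conn-ac = conn 1F 3F λ () }
    where
    o : Fin 4 → ℕ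
    o i = f i ⊖ f 0F
    conn : ∀ i j → i ≢ j → Conn k ∣ o i - o j ∣
    conn i j i≢j = adjacent⇒Conn (f 0F) (clique i j i≢j)
    from-0 : ∀ i → 0F ≢ i → Conn k (o i)
    from-0 i 0≢i = subst (λ t → Conn k ∣ t - o i ∣) (⊖-self (f 0F)) (conn 0F i 0≢i)
    apart : ∀ i j → i ≢ j → o i ≢ o j
    apart i j i≢j = i≢j ∘ f-inj ∘ ⊖-injectiveˡ (f 0F)

  private
    4k+1<n : suc (4 * k) < n
    4k+1<n = s≤s (begin-strict
      4 * k           <⟨ m<m+n (4 * k) (≤-trans 0<k (m≤m+n k (k + 0))) ⟩
      4 * k + 2 * k   ≡⟨ solve (k L.∷ L.[]) ⟩
      6 * k           ∎)
      where open ≤-Reasoning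

  -- u ⊕ (4k + 1) is u − 2k.
  offset-≤4k : ∀ u x → x ⊖ u ≤ 2 * k ⊎ 4 * k < x ⊖ u → x ⊖ (u ⊕ suc (4 * k)) ≤ 4 * k
  offset-≤4k u x (inj₁ o≤2k) = +-cancelʳ-≤ (suc (4 * k)) (x ⊖ (u ⊕ suc (4 * k))) (4 * k) (begin
    x ⊖ (u ⊕ suc (4 * k)) + suc (4 * k)
      ≡⟨ ⊖-⊕-above u x 4k+1<n (s≤s (≤-trans o≤2k 2k≤4k)) ⟩
    x ⊖ u + n                 ≤⟨ +-monoˡ-≤ n o≤2k ⟩
    2 * k + suc (6 * k)       ≡⟨ solve (k L.∷ L.[]) ⟩
    4 * k + suc (4 * k)       ∎)
    where
    open ≤-Reasoning
    2k≤4k : 2 * k ≤ 4 * k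
    2k≤4k = ≤-by (2 * k) (solve (k L.∷ L.[]))
  offset-≤4k u x (inj₂ 4k<o) = +-cancelʳ-≤ (suc (4 * k)) (x ⊖ (u ⊕ suc (4 * k))) (4 * k) (begin
    x ⊖ (u ⊕ suc (4 * k)) + suc (4 * k)   ≡⟨ ⊖-⊕-below u x 4k+1<n 4k<o ⟩
    x ⊖ u                                 ≤⟨ <⇒≤ (⊖<n x u) ⟩
    suc (6 * k)                           ≤⟨ ≤-by (2 * k) (solve (k L.∷ L.[])) ⟩
    4 * k + suc (4 * k)                   ∎)
    where open ≤-Reasoning

  no-independent-set : ¬ HasIndep G (2 + k)
  no-independent-set (f , f-inj , independent) =
    no-independent-offsets 0<k (λ i → f i ⊖ w) (f-inj ∘ ⊖-injectiveˡ w)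
      (λ i → offset-≤4k (f 0F) (f i) (near i))
      (λ i j i≢j → nonadjacent⇒¬Conn w (independent i j i≢j))
    where
    w : Fin n
    w = f 0F ⊕ suc (4 * k)
    near : ∀ i → f i ⊖ f 0F ≤ 2 * k ⊎ 4 * k < f i ⊖ f 0F
    near i with i Fin.≟ 0F
    ... | yes refl = inj₁ (subst (_≤ 2 * k) (sym (⊖-self (f 0F))) z≤n)
    ... | no i≢0   = ¬Conn⇒outside (subst (λ t → ¬ Conn k ∣ t - f i ⊖ f 0F ∣) (⊖-self (f 0F))
                                      (nonadjacent⇒¬Conn (f 0F) (independent 0F i (i≢0 ∘ sym))))

  adding-edge-creates-K₄ : ∀ u v (u≢v : u ≢ v) → adj G u v ≡ false →
                           HasClique (addEdge G u v u≢v) 4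
  adding-edge-creates-K₄ u v u≢v nonadjacent =
    homogeneous-from-either-end u v u≢v true (dec-true (conn? k _)) (Conn⇒pos 0<k)
      (Sum.swap (clique-offsets-either (⊖-flip u≢v) (does≡false⇒ (conn? k _) nonadjacent)))

  removing-edge-creates-independent : 2 ≤ k → ∀ u v (u≢v : u ≢ v) → adj G u v ≡ true →
                                      HasIndep (removeEdge G u v u≢v) (2 + k)
  removing-edge-creates-independent 2≤k u v u≢v adjacent =
    homogeneous-from-either-end u v u≢v false (dec-false (conn? k _) ∘ proj₂) proj₁
      (Sum.swap (independent-offsets-either 2≤k (⊖-flip u≢v) (does≡true⇒ (conn? k _) adjacent)))

  private
    ⊕≢ : ∀ u {a} → 0 < a → a < n → u ⊕ a ≢ u
    ⊕≢ u 0<a a<n eq =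
      <⇒≢ 0<a (sym (trans (sym (⊕-⊖ u a<n)) (trans (cong (_⊖ u) eq) (⊖-self u))))

    k<n : k < n
    k<n = s≤s (≤-by {k} {6 * k} (5 * k) (solve (k L.∷ L.[])))

  not-complete : 2 ≤ k → ¬ IsComplete G
  not-complete 2≤k complete = proj₂ (short-gap (s≤s z≤n) 2≤k)
    (subst (Conn k) (⊕-⊖ Fin.zero 1<n)
      (does≡true⇒ (conn? k _) (complete (Fin.zero ⊕ 1) Fin.zero (⊕≢ Fin.zero (s≤s z≤n) 1<n))))
    where
    1<n : 1 < n
    1<n = <-trans 2≤k k<n

  not-empty : ¬ ComplementComplete G
  not-empty empty = does≡false⇒ (conn? k _) (empty (Fin.zero ⊕ k) Fin.zero (⊕≢ Fin.zero 0<k k<n))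
    (subst (Conn k) (sym (⊕-⊖ Fin.zero k<n)) forward)

  doubly-saturated : 2 ≤ k → DoublySaturated 4 (2 + k) G
  doubly-saturated 2≤k =
    (K₄-free , no-independent-set) ,
    (λ u v u≢v nonadjacent good → proj₁ good (adding-edge-creates-K₄ u v u≢v nonadjacent)) ,
    (λ u v u≢v adjacent good → proj₂ good (removing-edge-creates-independent 2≤k u v u≢v adjacent)) ,
    not-complete 2≤k ,
    not-empty

theorem1 : ∀ (t : ℕ) → 4 ≤ t → Σ (Graph (6 * t ∸ 11)) λ G → DoublySaturated 4 t G
theorem1 t 4≤t with j , refl ← m≤n⇒∃[o]m+o≡n 4≤t =
  subst (λ N → Σ (Graph N) (DoublySaturated 4 (4 + j))) vertices
    (G , doubly-saturated (s≤s (s≤s z≤n)))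
  where
  open ExtremalGraph (2 + j) (s≤s z≤n)
  vertices : suc (6 * (2 + j)) ≡ 6 * (4 + j) ∸ 11
  vertices = begin
    suc (6 * (2 + j))             ≡⟨ m+n∸m≡n 11 (suc (6 * (2 + j))) ⟨
    11 + suc (6 * (2 + j)) ∸ 11   ≡⟨ cong (_∸ 11) expand ⟩
    6 * (4 + j) ∸ 11              ∎
    where
    open ≡-Reasoning
    expand : 11 + suc (6 * (2 + j)) ≡ 6 * (4 + j)
    expand = solve (j L.∷ L.[])
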